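{- For integers $N\ge i\ge 0$, let $D_{N,i}$ be the number of G-Motzkin paths of length $N$ with exactly $i$ $\mathbf{d}$-steps. Then for every integer $n\ge 0$, \[ \sum_{i=0}^{n}(-3)^{i}D_{n+i,i}=(-1)^{n}r_n, \] where $r_n$ is the $n$-th little Schröder number, i.e. the number of lattice paths from $(0,0)$ to $(2n,0)$ never going below the $x$-axis, with steps $(1,1)$, $(1,-1)$ and $(2,0)$, having no $(2,0)$-step on the $x$-axis.
   Context: A G-Motzkin path of length $N$ is a lattice path from $(0,0)$ to $(N,0)$ that never goes below the $x$-axis and consists of up steps $\mathbf{u}=(1,1)$, down steps $\mathbf{d}=(1,-1)$, horizontal steps $\mathbf{h}=(1,0)$ and vertical steps $\mathbf{v}=(0,-1)$. -}

module Defs where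

open import Data.Nat using (ℕ; zero; suc; _+_)
open import Data.Integer as ℤ using (ℤ)
open import Data.List using (List; []; _∷_)
open import Data.Maybe using (Maybe; just; nothing)
open import Data.Product using (Σ; _×_)
open import Relation.Binary.PropositionalEquality using (_≡_)

-- G-Motzkin paths
-- u = (1,1), d = (1,-1), h = (1,0), v = (0,-1)

data GStep : Set where
  u d h v : GStep

gRun : ℕ → List GStep → Maybe ℕ
gRun ht [] = just ht
gRun ht (u ∷ p) = gRun (suc ht) p
gRun zero (d ∷ p) = nothing
gRun (suc ht) (d ∷ p) = gRun ht p
gRun ht (h ∷ p) = gRun ht p
gRun zero (v ∷ p) = nothing
gRun (suc ht) (v ∷ p) = gRun ht p

gLength : List GStep → ℕ
gLength [] = 0
gLength (v ∷ p) = gLength p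
gLength (_ ∷ p) = suc (gLength p)

numD : List GStep → ℕ
numD [] = 0
numD (d ∷ p) = suc (numD p)
numD (_ ∷ p) = numD p

GMotzkin : ℕ → ℕ → Set
GMotzkin N i = Σ (List GStep) λ p → (gRun 0 p ≡ just 0) × (gLength p ≡ N) × (numD p ≡ i)

-- Little Schröder paths
-- U = (1,1), D = (1,-1), F = (2,0); no F-step on the x-axis

data SStep : Set where
  U D F : SStep

sRun : ℕ → List SStep → Maybe ℕ
sRun ht [] = just ht
sRun ht (U ∷ p) = sRun (suc ht) p
sRun zero (D ∷ p) = nothing
sRun (suc ht) (D ∷ p) = sRun ht p
sRun zero (F ∷ p) = nothing
sRun (suc ht) (F ∷ p) = sRun (suc ht) p

sLength : List SStep → ℕ
sLength [] = 0
sLength (F ∷ p) = suc (suc (sLength p))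
sLength (_ ∷ p) = suc (sLength p)

LittleSchroeder : ℕ → Set
LittleSchroeder n = Σ (List SStep) λ p → (sRun 0 p ≡ just 0) × (sLength p ≡ n + n)

sumTo : ℕ → (ℕ → ℤ) → ℤ
sumTo zero f = f 0
sumTo (suc n) f = sumTo n f ℤ.+ f (suc n)

-- Cutting a path after its first step gives recursions for the number of G-paths from height k
-- with m u/h-steps and i d-steps (as a polynomial in i), and for the number s(k, L) of little
-- Schröder paths of length L from height k.  Evaluating at -3 merges d- and v-steps into a single
-- down step of weight -2, and the resulting weights W(k, m) are determined by their first-step
-- recursion.  The numbers (-1)^(k+m) Σⱼ (k choose j) s(j, 2m + j) satisfy the same recursion, because
-- the diagonal binomial transform preserves the Schröder recursion and s(j, j) = 1.  At k = 0 this
-- gives W(0, n) = (-1)^n r_n, and W(0, n) is the left-hand side since a G-Motzkin path of length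
-- n + i with i d-steps has exactly n u/h-steps.

module Submission where

open import Defs
open import Data.Nat using (ℕ; zero; suc; _+_; _≤_; _<_; s≤s; z≤n)
open import Data.Nat.Properties
  using ( +-suc; +-identityʳ; +-cancelʳ-≡; +-monoʳ-≤; ≡-irrelevant
        ; m≤n+m; n≤1+n; n<1+n; m≤n⇒m≤1+n; m<n⇒m<1+n; ≤-trans)
open import Data.Nat.Tactic.RingSolver using () renaming (solve-∀ to ℕ-solve)
open import Data.Integer as ℤ using (ℤ; +_; -_; _*_; _^_; 0ℤ; 1ℤ; -1ℤ)
open import Data.Integer.Properties using (pos-+; *-identityˡ; *-zeroʳ; *-assoc; *-distribˡ-+)
  renaming (+-identityˡ to ℤ-+-identityˡ; +-identityʳ to ℤ-+-identityʳ; +-assoc to ℤ-+-assoc)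
open import Data.Integer.Tactic.RingSolver using () renaming (solve-∀ to ℤ-solve)
open import Data.Fin using (Fin)
open import Data.Fin.Properties using (+↔⊎; 0↔⊥; 1↔⊤)
open import Data.Fin.Permutation using (↔⇒≡)
open import Data.List using (List; []; _∷_; length)
open import Data.Maybe using (just)
open import Data.Product using (Σ; _×_; _,_)
open import Data.Sum using (_⊎_; inj₁; inj₂; [_,_])
open import Data.Sum.Function.Propositional using (_⊎-↔_)
open import Data.Unit using (⊤; tt)
open import Data.Empty using (⊥)
open import Function.Bundles using (_↔_; mk↔ₛ′)
open import Function.Construct.Composition using (_↔-∘_)
open import Function.Construct.Symmetry using (↔-sym)
open import Relation.Binary.PropositionalEquality
  using (_≡_; refl; sym; trans; cong; cong₂; subst; module ≡-Reasoning)

open ≡-Reasoning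

-- Finite sums and polynomials with natural coefficients, constant term first

sumTo-cong : ∀ n {f g : ℕ → ℤ} → (∀ i → f i ≡ g i) → sumTo n f ≡ sumTo n g
sumTo-cong zero    f≡g = f≡g 0
sumTo-cong (suc n) f≡g = cong₂ ℤ._+_ (sumTo-cong n f≡g) (f≡g (suc n))

sumTo-zero : ∀ n → sumTo n (λ _ → 0ℤ) ≡ 0ℤ
sumTo-zero zero    = refl
sumTo-zero (suc n) = cong (ℤ._+ 0ℤ) (sumTo-zero n)

sumTo-suc : ∀ n (f : ℕ → ℤ) → sumTo (suc n) f ≡ f 0 ℤ.+ sumTo n (λ i → f (suc i))
sumTo-suc zero    f = refl
sumTo-suc (suc n) f = trans (cong (ℤ._+ f (suc (suc n))) (sumTo-suc n f)) (ℤ-+-assoc (f 0) _ _)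

sumTo-*ˡ : ∀ n x (f : ℕ → ℤ) → sumTo n (λ i → x * f i) ≡ x * sumTo n f
sumTo-*ˡ zero    x f = refl
sumTo-*ˡ (suc n) x f = trans (cong (ℤ._+ x * f (suc n)) (sumTo-*ˡ n x f)) (sym (*-distribˡ-+ x _ _))

Poly : Set
Poly = List ℕ

_⊕_ : Poly → Poly → Poly
[]      ⊕ q       = q
(a ∷ p) ⊕ []      = a ∷ p
(a ∷ p) ⊕ (b ∷ q) = (a + b) ∷ (p ⊕ q)

coeff : Poly → ℕ → ℕ
coeff []      _       = 0
coeff (a ∷ p) zero    = a
coeff (a ∷ p) (suc i) = coeff p i

eval : ℤ → Poly → ℤ
eval x []      = 0ℤ
eval x (a ∷ p) = + a ℤ.+ x * eval x p

coeff-⊕ : ∀ p q i → coeff (p ⊕ q) i ≡ coeff p i + coeff q i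
coeff-⊕ []      q       i       = refl
coeff-⊕ (a ∷ p) []      i       = sym (+-identityʳ _)
coeff-⊕ (a ∷ p) (b ∷ q) zero    = refl
coeff-⊕ (a ∷ p) (b ∷ q) (suc i) = coeff-⊕ p q i

eval-⊕ : ∀ x p q → eval x (p ⊕ q) ≡ eval x p ℤ.+ eval x q
eval-⊕ x []      q       = sym (ℤ-+-identityˡ _)
eval-⊕ x (a ∷ p) []      = sym (ℤ-+-identityʳ _)
eval-⊕ x (a ∷ p) (b ∷ q) = begin
  + (a + b) ℤ.+ x * eval x (p ⊕ q)
    ≡⟨ cong₂ (λ c e → c ℤ.+ x * e) (pos-+ a b) (eval-⊕ x p q) ⟩
  (+ a ℤ.+ + b) ℤ.+ x * (eval x p ℤ.+ eval x q)
    ≡⟨ interchange x (+ a) (+ b) (eval x p) (eval x q) ⟩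
  (+ a ℤ.+ x * eval x p) ℤ.+ (+ b ℤ.+ x * eval x q) ∎
  where
  interchange : ∀ x a b e f → (a ℤ.+ b) ℤ.+ x * (e ℤ.+ f) ≡ (a ℤ.+ x * e) ℤ.+ (b ℤ.+ x * f)
  interchange = ℤ-solve

⊕-length-≤ : ∀ {n} p q → length p ≤ n → length q ≤ n → length (p ⊕ q) ≤ n
⊕-length-≤ []      q       _         q≤n       = q≤n
⊕-length-≤ (a ∷ p) []      p≤n       _         = p≤n
⊕-length-≤ (a ∷ p) (b ∷ q) (s≤s p≤n) (s≤s q≤n) = s≤s (⊕-length-≤ p q p≤n q≤n)

Fin+↔⊎ : ∀ {a b} {A B : Set} → Fin a ↔ A → Fin b ↔ B → Fin (a + b) ↔ (A ⊎ B)
Fin+↔⊎ f g = (f ⊎-↔ g) ↔-∘ +↔⊎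

Fin-coeff-⊕ : ∀ p q {i} {A B : Set} → Fin (coeff p i) ↔ A → Fin (coeff q i) ↔ B
            → Fin (coeff (p ⊕ q) i) ↔ (A ⊎ B)
Fin-coeff-⊕ p q {i} f g = subst (λ c → Fin c ↔ _) (sym (coeff-⊕ p q i)) (Fin+↔⊎ f g)

sumTo-coeff≡eval : ∀ x p n → length p ≤ suc n → sumTo n (λ i → x ^ i * + coeff p i) ≡ eval x p
sumTo-coeff≡eval x []          n       _ = trans (sumTo-cong n (λ i → *-zeroʳ (x ^ i))) (sumTo-zero n)
sumTo-coeff≡eval x (a ∷ [])    zero    _ = constant x (+ a)
  where
  constant : ∀ x a → 1ℤ * a ≡ a ℤ.+ x * 0ℤ
  constant = ℤ-solve
sumTo-coeff≡eval x (a ∷ _ ∷ _) zero    (s≤s ())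
sumTo-coeff≡eval x (a ∷ p)     (suc n) (s≤s len≤) = begin
  sumTo (suc n) (λ i → x ^ i * + coeff (a ∷ p) i)
    ≡⟨ sumTo-suc n _ ⟩
  1ℤ * + a ℤ.+ sumTo n (λ i → (x * x ^ i) * + coeff p i)
    ≡⟨ cong₂ ℤ._+_ (*-identityˡ (+ a)) (sumTo-cong n (λ i → *-assoc x (x ^ i) _)) ⟩
  + a ℤ.+ sumTo n (λ i → x * (x ^ i * + coeff p i))
    ≡⟨ cong (λ s → + a ℤ.+ s) (sumTo-*ˡ n x _) ⟩
  + a ℤ.+ x * sumTo n (λ i → x ^ i * + coeff p i)
    ≡⟨ cong (λ s → + a ℤ.+ x * s) (sumTo-coeff≡eval x p n len≤) ⟩
  + a ℤ.+ x * eval x p ∎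

-- The binomial transform along the diagonal

SchröderRecurrent : (ℕ → ℕ → ℕ) → Set
SchröderRecurrent f =
  ∀ k L → f (suc k) (suc (suc L)) ≡ f (suc (suc k)) (suc L) + (f k (suc L) + f (suc k) L)

DiagonalConstant : (ℕ → ℕ → ℕ) → Set
DiagonalConstant f = ∀ k → f k k ≡ f 0 0

diagonalStep : (ℕ → ℕ → ℕ) → ℕ → ℕ → ℕ
diagonalStep f k L = f k L + f (suc k) (suc L)

-- binomialTransform g f k L = Σⱼ (g choose j) · f (k + j) (L + j)
binomialTransform : ℕ → (ℕ → ℕ → ℕ) → ℕ → ℕ → ℕ
binomialTransform zero    f = f
binomialTransform (suc g) f = diagonalStep (binomialTransform g f)

binomialTransform-preserves : (P : (ℕ → ℕ → ℕ) → Set) → (∀ f → P f → P (diagonalStep f))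
                            → ∀ f → P f → ∀ g → P (binomialTransform g f)
binomialTransform-preserves P step f Pf zero    = Pf
binomialTransform-preserves P step f Pf (suc g) = step _ (binomialTransform-preserves P step f Pf g)

diagonalStep-recurrent : ∀ f → SchröderRecurrent f → SchröderRecurrent (diagonalStep f)
diagonalStep-recurrent f rec k L =
  trans (cong₂ _+_ (rec k L) (rec (suc k) (suc L)))
        (regroup (f (suc (suc k)) (suc L)) (f k (suc L)) (f (suc k) L)
                 (f (suc (suc (suc k))) (suc (suc L))) (f (suc k) (suc (suc L))))
  where
  regroup : ∀ a b c a′ b′ → (a + (b + c)) + (a′ + (b′ + a)) ≡ (a + a′) + ((b + b′) + (c + a))
  regroup = ℕ-solve

diagonalStep-diagonalConstant : ∀ f → DiagonalConstant f → DiagonalConstant (diagonalStep f)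
diagonalStep-diagonalConstant f const k = cong₂ _+_ (const k) (trans (const (suc k)) (sym (const 1)))

diagonalStep-at-axis : ∀ f → SchröderRecurrent f → ∀ L →
  diagonalStep f 0 (suc L) ≡ diagonalStep f 1 L + (f 0 (suc L) + f 0 (suc L))
diagonalStep-at-axis f rec L =
  trans (cong (λ n → f 0 (suc L) + n) (rec 0 L)) (regroup (f 0 (suc L)) (f 2 (suc L)) (f 1 L))
  where
  regroup : ∀ a b c → a + (b + (a + c)) ≡ (c + b) + (a + a)
  regroup = ℕ-solve

-- G-paths from height k to the axis

numUH : List GStep → ℕ
numUH []      = 0
numUH (u ∷ p) = suc (numUH p)
numUH (h ∷ p) = suc (numUH p)
numUH (d ∷ p) = numUH p
numUH (v ∷ p) = numUH p

gLength≡numUH+numD : ∀ p → gLength p ≡ numUH p + numD p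
gLength≡numUH+numD []      = refl
gLength≡numUH+numD (u ∷ p) = cong suc (gLength≡numUH+numD p)
gLength≡numUH+numD (h ∷ p) = cong suc (gLength≡numUH+numD p)
gLength≡numUH+numD (d ∷ p) = trans (cong suc (gLength≡numUH+numD p)) (sym (+-suc (numUH p) (numD p)))
gLength≡numUH+numD (v ∷ p) = gLength≡numUH+numD p

GPathFrom : ℕ → ℕ → ℕ → Set
GPathFrom k m i = Σ (List GStep) λ p → (gRun k p ≡ just 0) × (numUH p ≡ m) × (numD p ≡ i)

GMotzkin↔GPathFrom : ∀ n i → GMotzkin (n + i) i ↔ GPathFrom 0 n i
GMotzkin↔GPathFrom n i = mk↔ₛ′ to from
  (λ { (p , run , _ , #d) → cong (λ e → p , run , e , #d) (≡-irrelevant _ _) })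
  (λ { (p , run , _ , #d) → cong (λ e → p , run , e , #d) (≡-irrelevant _ _) })
  where
  to : GMotzkin (n + i) i → GPathFrom 0 n i
  to (p , run , len , #d) = p , run , +-cancelʳ-≡ i (numUH p) n #uh+i≡n+i , #d
    where
    #uh+i≡n+i : numUH p + i ≡ n + i
    #uh+i≡n+i = trans (cong (λ j → numUH p + j) (sym #d)) (trans (sym (gLength≡numUH+numD p)) len)
  from : GPathFrom 0 n i → GMotzkin (n + i) i
  from (p , run , #uh , #d) = p , run , trans (gLength≡numUH+numD p) (cong₂ _+_ #uh #d) , #d

GEmpty GAfterU GAfterH GAfterD GAfterV : ℕ → ℕ → ℕ → Set
GEmpty zero zero zero = ⊤
GEmpty _    _    _    = ⊥
GAfterU k zero    i = ⊥
GAfterU k (suc m) i = GPathFrom (suc k) m i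
GAfterH k zero    i = ⊥
GAfterH k (suc m) i = GPathFrom k m i
GAfterD zero    m i       = ⊥
GAfterD (suc k) m zero    = ⊥
GAfterD (suc k) m (suc i) = GPathFrom k m i
GAfterV zero    m i = ⊥
GAfterV (suc k) m i = GPathFrom k m i

GFirstStep : ℕ → ℕ → ℕ → Set
GFirstStep k m i = GEmpty k m i ⊎ GAfterU k m i ⊎ GAfterH k m i ⊎ GAfterD k m i ⊎ GAfterV k m i

-- Matching on the path before the height keeps gFirstStep computing on open heights.
gFirstStepOf : ∀ p {k m i} → gRun k p ≡ just 0 → numUH p ≡ m → numD p ≡ i → GFirstStep k m i
gFirstStepOf []      refl refl refl         = inj₁ tt
gFirstStepOf (u ∷ p) run refl #d            = inj₂ (inj₁ (p , run , refl , #d))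
gFirstStepOf (h ∷ p) run refl #d            = inj₂ (inj₂ (inj₁ (p , run , refl , #d)))
gFirstStepOf (d ∷ p) {zero}  () _ _
gFirstStepOf (d ∷ p) {suc k} run #uh refl   = inj₂ (inj₂ (inj₂ (inj₁ (p , run , #uh , refl))))
gFirstStepOf (v ∷ p) {zero}  () _ _
gFirstStepOf (v ∷ p) {suc k} run #uh #d     = inj₂ (inj₂ (inj₂ (inj₂ (p , run , #uh , #d))))

gFirstStep : ∀ {k m i} → GPathFrom k m i → GFirstStep k m i
gFirstStep (p , run , #uh , #d) = gFirstStepOf p run #uh #d

gEmptyPath : ∀ {k m i} → GEmpty k m i → GPathFrom k m i
gEmptyPath {zero} {zero} {zero} tt = [] , refl , refl , refl

gPrependU : ∀ {k m i} → GAfterU k m i → GPathFrom k m i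
gPrependU {m = suc m} (p , run , #uh , #d) = u ∷ p , run , cong suc #uh , #d

gPrependH : ∀ {k m i} → GAfterH k m i → GPathFrom k m i
gPrependH {m = suc m} (p , run , #uh , #d) = h ∷ p , run , cong suc #uh , #d

gPrependD : ∀ {k m i} → GAfterD k m i → GPathFrom k m i
gPrependD {suc k} {i = suc i} (p , run , #uh , #d) = d ∷ p , run , #uh , cong suc #d

gPrependV : ∀ {k m i} → GAfterV k m i → GPathFrom k m i
gPrependV {suc k} (p , run , #uh , #d) = v ∷ p , run , #uh , #d

gPrepend : ∀ {k m i} → GFirstStep k m i → GPathFrom k m i
gPrepend = [ gEmptyPath , [ gPrependU , [ gPrependH , [ gPrependD , gPrependV ] ] ] ]

gFirstStep∘gPrepend : ∀ {k m i} (x : GFirstStep k m i) → gFirstStep (gPrepend x) ≡ x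
gFirstStep∘gPrepend (inj₁ x)                         = empty x
  where
  empty : ∀ {k m i} (x : GEmpty k m i) → gFirstStep (gEmptyPath x) ≡ inj₁ x
  empty {zero} {zero} {zero} tt = refl
gFirstStep∘gPrepend (inj₂ (inj₁ x))                  = afterU x
  where
  afterU : ∀ {k m i} (x : GAfterU k m i) → gFirstStep (gPrependU x) ≡ inj₂ (inj₁ x)
  afterU {m = suc m} (p , run , refl , #d) = refl
gFirstStep∘gPrepend (inj₂ (inj₂ (inj₁ x)))           = afterH x
  where
  afterH : ∀ {k m i} (x : GAfterH k m i) → gFirstStep (gPrependH x) ≡ inj₂ (inj₂ (inj₁ x))
  afterH {m = suc m} (p , run , refl , #d) = refl
gFirstStep∘gPrepend (inj₂ (inj₂ (inj₂ (inj₁ x))))    = afterD x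
  where
  afterD : ∀ {k m i} (x : GAfterD k m i) → gFirstStep (gPrependD x) ≡ inj₂ (inj₂ (inj₂ (inj₁ x)))
  afterD {suc k} {i = suc i} (p , run , #uh , refl) = refl
gFirstStep∘gPrepend (inj₂ (inj₂ (inj₂ (inj₂ x))))    = afterV x
  where
  afterV : ∀ {k m i} (x : GAfterV k m i) → gFirstStep (gPrependV x) ≡ inj₂ (inj₂ (inj₂ (inj₂ x)))
  afterV {suc k} (p , run , #uh , #d) = refl

gPrepend∘gFirstStepOf : ∀ p {k m i} (run : gRun k p ≡ just 0) (#uh : numUH p ≡ m) (#d : numD p ≡ i)
                      → gPrepend (gFirstStepOf p run #uh #d) ≡ (p , run , #uh , #d)
gPrepend∘gFirstStepOf []      refl refl refl       = refl
gPrepend∘gFirstStepOf (u ∷ p) run refl #d          = refl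
gPrepend∘gFirstStepOf (h ∷ p) run refl #d          = refl
gPrepend∘gFirstStepOf (d ∷ p) {zero}  () _ _
gPrepend∘gFirstStepOf (d ∷ p) {suc k} run #uh refl = refl
gPrepend∘gFirstStepOf (v ∷ p) {zero}  () _ _
gPrepend∘gFirstStepOf (v ∷ p) {suc k} run #uh #d   = refl

GPathFrom↔GFirstStep : ∀ {k m i} → GPathFrom k m i ↔ GFirstStep k m i
GPathFrom↔GFirstStep = mk↔ₛ′ gFirstStep gPrepend gFirstStep∘gPrepend
  (λ { (p , run , #uh , #d) → gPrepend∘gFirstStepOf p run #uh #d })

gPoly gEmptyPoly gAfterUPoly gAfterHPoly gAfterDPoly gAfterVPoly : ℕ → ℕ → Poly
gPoly k m = gEmptyPoly k m ⊕ (gAfterUPoly k m ⊕ (gAfterHPoly k m ⊕ (gAfterDPoly k m ⊕ gAfterVPoly k m)))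
gEmptyPoly zero zero = 1 ∷ []
gEmptyPoly _    _    = []
gAfterUPoly k zero    = []
gAfterUPoly k (suc m) = gPoly (suc k) m
gAfterHPoly k zero    = []
gAfterHPoly k (suc m) = gPoly k m
gAfterDPoly zero    m = []
gAfterDPoly (suc k) m = 0 ∷ gPoly k m
gAfterVPoly zero    m = []
gAfterVPoly (suc k) m = gPoly k m

Fin-gPoly↔GPathFrom : ∀ k m i → Fin (coeff (gPoly k m) i) ↔ GPathFrom k m i
Fin-gEmptyPoly↔GEmpty : ∀ k m i → Fin (coeff (gEmptyPoly k m) i) ↔ GEmpty k m i
Fin-gAfterUPoly↔GAfterU : ∀ k m i → Fin (coeff (gAfterUPoly k m) i) ↔ GAfterU k m i
Fin-gAfterHPoly↔GAfterH : ∀ k m i → Fin (coeff (gAfterHPoly k m) i) ↔ GAfterH k m i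
Fin-gAfterDPoly↔GAfterD : ∀ k m i → Fin (coeff (gAfterDPoly k m) i) ↔ GAfterD k m i
Fin-gAfterVPoly↔GAfterV : ∀ k m i → Fin (coeff (gAfterVPoly k m) i) ↔ GAfterV k m i

Fin-gPoly↔GPathFrom k m i =
  ↔-sym GPathFrom↔GFirstStep ↔-∘
  Fin-coeff-⊕ (gEmptyPoly k m) _ (Fin-gEmptyPoly↔GEmpty k m i)
  (Fin-coeff-⊕ (gAfterUPoly k m) _ (Fin-gAfterUPoly↔GAfterU k m i)
  (Fin-coeff-⊕ (gAfterHPoly k m) _ (Fin-gAfterHPoly↔GAfterH k m i)
  (Fin-coeff-⊕ (gAfterDPoly k m) _ (Fin-gAfterDPoly↔GAfterD k m i)
  (Fin-gAfterVPoly↔GAfterV k m i))))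

Fin-gEmptyPoly↔GEmpty zero    zero    zero    = 1↔⊤
Fin-gEmptyPoly↔GEmpty zero    zero    (suc i) = 0↔⊥
Fin-gEmptyPoly↔GEmpty zero    (suc m) i       = 0↔⊥
Fin-gEmptyPoly↔GEmpty (suc k) m       i       = 0↔⊥

Fin-gAfterUPoly↔GAfterU k zero    i = 0↔⊥
Fin-gAfterUPoly↔GAfterU k (suc m) i = Fin-gPoly↔GPathFrom (suc k) m i

Fin-gAfterHPoly↔GAfterH k zero    i = 0↔⊥
Fin-gAfterHPoly↔GAfterH k (suc m) i = Fin-gPoly↔GPathFrom k m i

Fin-gAfterDPoly↔GAfterD zero    m i       = 0↔⊥
Fin-gAfterDPoly↔GAfterD (suc k) m zero    = 0↔⊥
Fin-gAfterDPoly↔GAfterD (suc k) m (suc i) = Fin-gPoly↔GPathFrom k m i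

Fin-gAfterVPoly↔GAfterV zero    m i = 0↔⊥
Fin-gAfterVPoly↔GAfterV (suc k) m i = Fin-gPoly↔GPathFrom k m i

gPoly-length : ∀ k m → length (gPoly k m) ≤ suc (k + m)
gEmptyPoly-length : ∀ k m → length (gEmptyPoly k m) ≤ suc (k + m)
gAfterUPoly-length : ∀ k m → length (gAfterUPoly k m) ≤ suc (k + m)
gAfterHPoly-length : ∀ k m → length (gAfterHPoly k m) ≤ suc (k + m)
gAfterDPoly-length : ∀ k m → length (gAfterDPoly k m) ≤ suc (k + m)
gAfterVPoly-length : ∀ k m → length (gAfterVPoly k m) ≤ suc (k + m)

gPoly-length k m =
  ⊕-length-≤ (gEmptyPoly k m) _ (gEmptyPoly-length k m)
  (⊕-length-≤ (gAfterUPoly k m) _ (gAfterUPoly-length k m)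
  (⊕-length-≤ (gAfterHPoly k m) _ (gAfterHPoly-length k m)
  (⊕-length-≤ (gAfterDPoly k m) _ (gAfterDPoly-length k m) (gAfterVPoly-length k m))))

gEmptyPoly-length zero    zero    = s≤s z≤n
gEmptyPoly-length zero    (suc m) = z≤n
gEmptyPoly-length (suc k) m       = z≤n

gAfterUPoly-length k zero    = z≤n
gAfterUPoly-length k (suc m) =
  subst (λ n → length (gPoly (suc k) m) ≤ suc n) (sym (+-suc k m)) (gPoly-length (suc k) m)

gAfterHPoly-length k zero    = z≤n
gAfterHPoly-length k (suc m) = ≤-trans (gPoly-length k m) (s≤s (+-monoʳ-≤ k (n≤1+n m)))

gAfterDPoly-length zero    m = z≤n
gAfterDPoly-length (suc k) m = s≤s (gPoly-length k m)

gAfterVPoly-length zero    m = z≤n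
gAfterVPoly-length (suc k) m = m≤n⇒m≤1+n (gPoly-length k m)

-- The first-step recursion for paths with up, level and down steps, a down step weighing -2,
-- by starting height and number of up and level steps.
record WeightedMotzkinRecurrence (w : ℕ → ℕ → ℤ) : Set where
  field
    origin   : w 0 0 ≡ 1ℤ
    suc-zero : ∀ k → w (suc k) 0 ≡ - (+ 2) * w k 0
    zero-suc : ∀ m → w 0 (suc m) ≡ w 1 m ℤ.+ w 0 m
    suc-suc  : ∀ k m → w (suc k) (suc m) ≡ w (suc (suc k)) m ℤ.+ (w (suc k) m ℤ.+ - (+ 2) * w k (suc m))

WeightedMotzkinRecurrence-unique : ∀ {w w′} → WeightedMotzkinRecurrence w → WeightedMotzkinRecurrence w′
                                 → ∀ k m → w k m ≡ w′ k m
WeightedMotzkinRecurrence-unique {w} {w′} R R′ = go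
  where
  module R = WeightedMotzkinRecurrence R
  module R′ = WeightedMotzkinRecurrence R′
  go : ∀ k m → w k m ≡ w′ k m
  go zero    zero    = trans R.origin (sym R′.origin)
  go (suc k) zero    = trans (R.suc-zero k) (trans (cong (λ x → - (+ 2) * x) (go k 0)) (sym (R′.suc-zero k)))
  go zero    (suc m) = trans (R.zero-suc m) (trans (cong₂ ℤ._+_ (go 1 m) (go 0 m)) (sym (R′.zero-suc m)))
  go (suc k) (suc m) = trans (R.suc-suc k m) (trans
    (cong₂ ℤ._+_ (go (suc (suc k)) m) (cong₂ (λ x y → x ℤ.+ - (+ 2) * y) (go (suc k) m) (go k (suc m))))
    (sym (R′.suc-suc k m)))

-- Weighting every d-step by -3: a d-step and a v-step then together act as one down step of weight -2.
gWeight : ℕ → ℕ → ℤ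
gWeight k m = eval (- (+ 3)) (gPoly k m)

gWeight-by-first-step : ∀ k m → gWeight k m ≡
  eval (- (+ 3)) (gEmptyPoly k m) ℤ.+ (eval (- (+ 3)) (gAfterUPoly k m) ℤ.+ (eval (- (+ 3)) (gAfterHPoly k m)
  ℤ.+ (eval (- (+ 3)) (gAfterDPoly k m) ℤ.+ eval (- (+ 3)) (gAfterVPoly k m))))
gWeight-by-first-step k m =
  trans (eval-⊕ x (gEmptyPoly k m) _) (cong (λ w → eval x (gEmptyPoly k m) ℤ.+ w)
  (trans (eval-⊕ x (gAfterUPoly k m) _) (cong (λ w → eval x (gAfterUPoly k m) ℤ.+ w)
  (trans (eval-⊕ x (gAfterHPoly k m) _) (cong (λ w → eval x (gAfterHPoly k m) ℤ.+ w)
  (eval-⊕ x (gAfterDPoly k m) (gAfterVPoly k m)))))))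
  where
  x = - (+ 3)

gWeight-recurrence : WeightedMotzkinRecurrence gWeight
gWeight-recurrence = record
  { origin   = refl
  ; suc-zero = λ k → trans (gWeight-by-first-step (suc k) 0) (down (gWeight k 0))
  ; zero-suc = λ m → trans (gWeight-by-first-step 0 (suc m)) (up-or-level (gWeight 1 m) (gWeight 0 m))
  ; suc-suc  = λ k m → trans (gWeight-by-first-step (suc k) (suc m))
                             (any-step (gWeight (suc (suc k)) m) (gWeight (suc k) m) (gWeight k (suc m)))
  }
  where
  down : ∀ w → 0ℤ ℤ.+ (0ℤ ℤ.+ (0ℤ ℤ.+ ((0ℤ ℤ.+ - (+ 3) * w) ℤ.+ w))) ≡ - (+ 2) * w
  down = ℤ-solve
  up-or-level : ∀ a b → 0ℤ ℤ.+ (a ℤ.+ (b ℤ.+ (0ℤ ℤ.+ 0ℤ))) ≡ a ℤ.+ b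
  up-or-level = ℤ-solve
  any-step : ∀ a b w → 0ℤ ℤ.+ (a ℤ.+ (b ℤ.+ ((0ℤ ℤ.+ - (+ 3) * w) ℤ.+ w))) ≡ a ℤ.+ (b ℤ.+ - (+ 2) * w)
  any-step = ℤ-solve

-- Little Schröder paths from height k to the axis

SPathFrom : ℕ → ℕ → Set
SPathFrom k L = Σ (List SStep) λ p → (sRun k p ≡ just 0) × (sLength p ≡ L)

SEmpty SAfterU SAfterD SAfterF : ℕ → ℕ → Set
SEmpty zero zero = ⊤
SEmpty _    _    = ⊥
SAfterU k zero    = ⊥
SAfterU k (suc L) = SPathFrom (suc k) L
SAfterD zero    L       = ⊥
SAfterD (suc k) zero    = ⊥
SAfterD (suc k) (suc L) = SPathFrom k L
SAfterF zero    L             = ⊥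
SAfterF (suc k) zero          = ⊥
SAfterF (suc k) (suc zero)    = ⊥
SAfterF (suc k) (suc (suc L)) = SPathFrom (suc k) L

SFirstStep : ℕ → ℕ → Set
SFirstStep k L = SEmpty k L ⊎ SAfterU k L ⊎ SAfterD k L ⊎ SAfterF k L

sFirstStepOf : ∀ p {k L} → sRun k p ≡ just 0 → sLength p ≡ L → SFirstStep k L
sFirstStepOf []      refl refl         = inj₁ tt
sFirstStepOf (U ∷ p) run refl          = inj₂ (inj₁ (p , run , refl))
sFirstStepOf (D ∷ p) {zero}  () _
sFirstStepOf (D ∷ p) {suc k} run refl  = inj₂ (inj₂ (inj₁ (p , run , refl)))
sFirstStepOf (F ∷ p) {zero}  () _
sFirstStepOf (F ∷ p) {suc k} run refl  = inj₂ (inj₂ (inj₂ (p , run , refl)))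

sFirstStep : ∀ {k L} → SPathFrom k L → SFirstStep k L
sFirstStep (p , run , len) = sFirstStepOf p run len

sEmptyPath : ∀ {k L} → SEmpty k L → SPathFrom k L
sEmptyPath {zero} {zero} tt = [] , refl , refl

sPrependU : ∀ {k L} → SAfterU k L → SPathFrom k L
sPrependU {L = suc L} (p , run , len) = U ∷ p , run , cong suc len

sPrependD : ∀ {k L} → SAfterD k L → SPathFrom k L
sPrependD {suc k} {suc L} (p , run , len) = D ∷ p , run , cong suc len

sPrependF : ∀ {k L} → SAfterF k L → SPathFrom k L
sPrependF {suc k} {suc (suc L)} (p , run , len) = F ∷ p , run , cong (λ n → suc (suc n)) len

sPrepend : ∀ {k L} → SFirstStep k L → SPathFrom k L
sPrepend = [ sEmptyPath , [ sPrependU , [ sPrependD , sPrependF ] ] ]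

sFirstStep∘sPrepend : ∀ {k L} (x : SFirstStep k L) → sFirstStep (sPrepend x) ≡ x
sFirstStep∘sPrepend (inj₁ x)                = empty x
  where
  empty : ∀ {k L} (x : SEmpty k L) → sFirstStep (sEmptyPath x) ≡ inj₁ x
  empty {zero} {zero} tt = refl
sFirstStep∘sPrepend (inj₂ (inj₁ x))         = afterU x
  where
  afterU : ∀ {k L} (x : SAfterU k L) → sFirstStep (sPrependU x) ≡ inj₂ (inj₁ x)
  afterU {L = suc L} (p , run , refl) = refl
sFirstStep∘sPrepend (inj₂ (inj₂ (inj₁ x)))  = afterD x
  where
  afterD : ∀ {k L} (x : SAfterD k L) → sFirstStep (sPrependD x) ≡ inj₂ (inj₂ (inj₁ x))
  afterD {suc k} {suc L} (p , run , refl) = refl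
sFirstStep∘sPrepend (inj₂ (inj₂ (inj₂ x)))  = afterF x
  where
  afterF : ∀ {k L} (x : SAfterF k L) → sFirstStep (sPrependF x) ≡ inj₂ (inj₂ (inj₂ x))
  afterF {suc k} {suc (suc L)} (p , run , refl) = refl

sPrepend∘sFirstStepOf : ∀ p {k L} (run : sRun k p ≡ just 0) (len : sLength p ≡ L)
                      → sPrepend (sFirstStepOf p run len) ≡ (p , run , len)
sPrepend∘sFirstStepOf []      refl refl        = refl
sPrepend∘sFirstStepOf (U ∷ p) run refl         = refl
sPrepend∘sFirstStepOf (D ∷ p) {zero}  () _
sPrepend∘sFirstStepOf (D ∷ p) {suc k} run refl = refl
sPrepend∘sFirstStepOf (F ∷ p) {zero}  () _
sPrepend∘sFirstStepOf (F ∷ p) {suc k} run refl = refl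

SPathFrom↔SFirstStep : ∀ {k L} → SPathFrom k L ↔ SFirstStep k L
SPathFrom↔SFirstStep = mk↔ₛ′ sFirstStep sPrepend sFirstStep∘sPrepend
  (λ { (p , run , len) → sPrepend∘sFirstStepOf p run len })

sCount sEmptyCount sAfterUCount sAfterDCount sAfterFCount : ℕ → ℕ → ℕ
sCount k L = sEmptyCount k L + (sAfterUCount k L + (sAfterDCount k L + sAfterFCount k L))
sEmptyCount zero zero = 1
sEmptyCount _    _    = 0
sAfterUCount k zero    = 0
sAfterUCount k (suc L) = sCount (suc k) L
sAfterDCount zero    L       = 0
sAfterDCount (suc k) zero    = 0
sAfterDCount (suc k) (suc L) = sCount k L
sAfterFCount zero    L             = 0
sAfterFCount (suc k) zero          = 0
sAfterFCount (suc k) (suc zero)    = 0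
sAfterFCount (suc k) (suc (suc L)) = sCount (suc k) L

Fin-sCount↔SPathFrom : ∀ k L → Fin (sCount k L) ↔ SPathFrom k L
Fin-sEmptyCount↔SEmpty : ∀ k L → Fin (sEmptyCount k L) ↔ SEmpty k L
Fin-sAfterUCount↔SAfterU : ∀ k L → Fin (sAfterUCount k L) ↔ SAfterU k L
Fin-sAfterDCount↔SAfterD : ∀ k L → Fin (sAfterDCount k L) ↔ SAfterD k L
Fin-sAfterFCount↔SAfterF : ∀ k L → Fin (sAfterFCount k L) ↔ SAfterF k L

Fin-sCount↔SPathFrom k L =
  ↔-sym SPathFrom↔SFirstStep ↔-∘
  Fin+↔⊎ (Fin-sEmptyCount↔SEmpty k L) (Fin+↔⊎ (Fin-sAfterUCount↔SAfterU k L)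
  (Fin+↔⊎ (Fin-sAfterDCount↔SAfterD k L) (Fin-sAfterFCount↔SAfterF k L)))

Fin-sEmptyCount↔SEmpty zero    zero    = 1↔⊤
Fin-sEmptyCount↔SEmpty zero    (suc L) = 0↔⊥
Fin-sEmptyCount↔SEmpty (suc k) L       = 0↔⊥

Fin-sAfterUCount↔SAfterU k zero    = 0↔⊥
Fin-sAfterUCount↔SAfterU k (suc L) = Fin-sCount↔SPathFrom (suc k) L

Fin-sAfterDCount↔SAfterD zero    L       = 0↔⊥
Fin-sAfterDCount↔SAfterD (suc k) zero    = 0↔⊥
Fin-sAfterDCount↔SAfterD (suc k) (suc L) = Fin-sCount↔SPathFrom k L

Fin-sAfterFCount↔SAfterF zero    L             = 0↔⊥
Fin-sAfterFCount↔SAfterF (suc k) zero          = 0↔⊥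
Fin-sAfterFCount↔SAfterF (suc k) (suc zero)    = 0↔⊥
Fin-sAfterFCount↔SAfterF (suc k) (suc (suc L)) = Fin-sCount↔SPathFrom (suc k) L

sCount-recurrent : SchröderRecurrent sCount
sCount-recurrent k L = refl

sCount-from-axis : ∀ L → sCount 0 (suc L) ≡ sCount 1 L
sCount-from-axis L = +-identityʳ (sCount 1 L)

sCount-below : ∀ k L → L < k → sCount k L ≡ 0
sCount-below (suc k)       zero          _         = refl
sCount-below (suc (suc k)) (suc zero)    _         = refl
sCount-below (suc k)       (suc (suc L)) (s≤s L<k) = cong₂ _+_
  (sCount-below (suc (suc k)) (suc L) (m<n⇒m<1+n (m<n⇒m<1+n L<k)))
  (cong₂ _+_ (sCount-below k (suc L) L<k) (sCount-below (suc k) L (m<n⇒m<1+n (≤-trans (n≤1+n _) L<k))))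

sCount-diagonal : DiagonalConstant sCount
sCount-diagonal zero          = refl
sCount-diagonal (suc zero)    = refl
sCount-diagonal (suc (suc k)) = cong₂ _+_
  (sCount-below (suc (suc (suc k))) (suc k) (m<n⇒m<1+n (n<1+n (suc k))))
  (cong₂ _+_ (sCount-diagonal (suc k)) (sCount-below (suc (suc k)) k (m<n⇒m<1+n (n<1+n k))))

-- Signed binomial transforms of little Schröder numbers

sign : ℕ → ℤ
sign n = -1ℤ ^ n

twice : ℕ → ℕ
twice zero    = zero
twice (suc m) = suc (suc (twice m))

twice≡+ : ∀ n → twice n ≡ n + n
twice≡+ zero    = refl
twice≡+ (suc n) = cong suc (trans (cong suc (twice≡+ n)) (sym (+-suc n n)))

schröderSum : ℕ → ℕ → ℕ
schröderSum k m = binomialTransform k sCount 0 (twice m)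

signedSchröderSum : ℕ → ℕ → ℤ
signedSchröderSum k m = sign k * (sign m * + schröderSum k m)

signedSchröderSum-recurrence : WeightedMotzkinRecurrence signedSchröderSum
signedSchröderSum-recurrence = record
  { origin = refl ; suc-zero = suc-zero ; zero-suc = zero-suc ; suc-suc = suc-suc }
  where
  suc-zero : ∀ g → signedSchröderSum (suc g) 0 ≡ - (+ 2) * signedSchröderSum g 0
  suc-zero g = begin
    sign (suc g) * (1ℤ * + (t + binomialTransform g sCount 1 1))
      ≡⟨ cong (λ n → sign (suc g) * (1ℤ * + (t + n))) (diagonal 1) ⟩
    sign (suc g) * (1ℤ * + (t + t))
      ≡⟨ cong (λ w → sign (suc g) * (1ℤ * w)) (pos-+ t t) ⟩
    sign (suc g) * (1ℤ * (+ t ℤ.+ + t))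
      ≡⟨ doubling (sign g) (+ t) ⟩
    - (+ 2) * (sign g * (1ℤ * + t)) ∎
    where
    t = binomialTransform g sCount 0 0
    diagonal : DiagonalConstant (binomialTransform g sCount)
    diagonal = binomialTransform-preserves DiagonalConstant diagonalStep-diagonalConstant sCount sCount-diagonal g
    doubling : ∀ e t → (-1ℤ * e) * (1ℤ * (t ℤ.+ t)) ≡ - (+ 2) * (e * (1ℤ * t))
    doubling = ℤ-solve

  zero-suc : ∀ m → signedSchröderSum 0 (suc m) ≡ signedSchröderSum 1 m ℤ.+ signedSchröderSum 0 m
  zero-suc m = begin
    1ℤ * (sign (suc m) * + sCount 0 (twice (suc m)))
      ≡⟨ cong (λ n → 1ℤ * (sign (suc m) * + n)) (sCount-from-axis (suc (twice m))) ⟩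
    1ℤ * (sign (suc m) * + b)
      ≡⟨ cancel (sign m) (+ a) (+ b) ⟩
    sign 1 * (sign m * (+ a ℤ.+ + b)) ℤ.+ 1ℤ * (sign m * + a)
      ≡⟨ cong (λ w → sign 1 * (sign m * w) ℤ.+ 1ℤ * (sign m * + a)) (sym (pos-+ a b)) ⟩
    sign 1 * (sign m * + (a + b)) ℤ.+ 1ℤ * (sign m * + a) ∎
    where
    a = sCount 0 (twice m)
    b = sCount 1 (suc (twice m))
    cancel : ∀ s a b → 1ℤ * ((-1ℤ * s) * b) ≡ (-1ℤ * 1ℤ) * (s * (a ℤ.+ b)) ℤ.+ 1ℤ * (s * a)
    cancel = ℤ-solve

  suc-suc : ∀ g m → signedSchröderSum (suc g) (suc m) ≡
    signedSchröderSum (suc (suc g)) m ℤ.+ (signedSchröderSum (suc g) m ℤ.+ - (+ 2) * signedSchröderSum g (suc m))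
  suc-suc g m = begin
    sign (suc g) * (sign (suc m) * + binomialTransform (suc g) sCount 0 (twice (suc m)))
      ≡⟨ cong (λ w → sign (suc g) * (sign (suc m) * w)) at-axis ⟩
    sign (suc g) * (sign (suc m) * (+ b ℤ.+ (+ c ℤ.+ + c)))
      ≡⟨ regroup (sign g) (sign m) (+ a) (+ b) (+ c) ⟩
    sign (suc (suc g)) * (sign m * (+ a ℤ.+ + b)) ℤ.+ rest
      ≡⟨ cong (λ w → sign (suc (suc g)) * (sign m * w) ℤ.+ rest) (sym (pos-+ a b)) ⟩
    sign (suc (suc g)) * (sign m * + (a + b)) ℤ.+ rest ∎
    where
    a = binomialTransform (suc g) sCount 0 (twice m)
    b = binomialTransform (suc g) sCount 1 (suc (twice m))
    c = binomialTransform g sCount 0 (twice (suc m))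
    rest = sign (suc g) * (sign m * + a) ℤ.+ - (+ 2) * (sign g * (sign (suc m) * + c))
    recurrent : SchröderRecurrent (binomialTransform g sCount)
    recurrent = binomialTransform-preserves SchröderRecurrent diagonalStep-recurrent sCount sCount-recurrent g
    at-axis : + binomialTransform (suc g) sCount 0 (twice (suc m)) ≡ + b ℤ.+ (+ c ℤ.+ + c)
    at-axis = trans (cong +_ (diagonalStep-at-axis (binomialTransform g sCount) recurrent (suc (twice m))))
                    (trans (pos-+ b (c + c)) (cong (λ w → + b ℤ.+ w) (pos-+ c c)))
    regroup : ∀ e s a b c → (-1ℤ * e) * ((-1ℤ * s) * (b ℤ.+ (c ℤ.+ c)))
      ≡ (-1ℤ * (-1ℤ * e)) * (s * (a ℤ.+ b)) ℤ.+ ((-1ℤ * e) * (s * a) ℤ.+ - (+ 2) * (e * ((-1ℤ * s) * c)))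
    regroup = ℤ-solve

corollary2p11 : (D : ℕ → ℕ → ℕ) (r : ℕ → ℕ)
    → (∀ N i → i ≤ N → Fin (D N i) ↔ GMotzkin N i)
    → (∀ n → Fin (r n) ↔ LittleSchroeder n)
    → ∀ n → sumTo n (λ i → ((- (+ 3)) ^ i) * (+ (D (n + i) i))) ≡ ((- (+ 1)) ^ n) * (+ (r n))
corollary2p11 D′ r D↔GMotzkin r↔LittleSchroeder n = begin
  sumTo n (λ i → (- (+ 3)) ^ i * + D′ (n + i) i)
    ≡⟨ sumTo-cong n (λ i → cong (λ c → (- (+ 3)) ^ i * + c) (D≡coeff i)) ⟩
  sumTo n (λ i → (- (+ 3)) ^ i * + coeff (gPoly 0 n) i)
    ≡⟨ sumTo-coeff≡eval (- (+ 3)) (gPoly 0 n) n (gPoly-length 0 n) ⟩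
  gWeight 0 n
    ≡⟨ WeightedMotzkinRecurrence-unique gWeight-recurrence signedSchröderSum-recurrence 0 n ⟩
  1ℤ * (sign n * + sCount 0 (twice n))
    ≡⟨ *-identityˡ _ ⟩
  sign n * + sCount 0 (twice n)
    ≡⟨ cong (λ c → sign n * + c) (sym r≡sCount) ⟩
  (- (+ 1)) ^ n * + r n ∎
  where
  D≡coeff : ∀ i → D′ (n + i) i ≡ coeff (gPoly 0 n) i
  D≡coeff i = ↔⇒≡ (↔-sym (Fin-gPoly↔GPathFrom 0 n i) ↔-∘
                   (GMotzkin↔GPathFrom n i ↔-∘ D↔GMotzkin (n + i) i (m≤n+m i n)))
  r≡sCount : r n ≡ sCount 0 (twice n)
  r≡sCount = trans (↔⇒≡ (↔-sym (Fin-sCount↔SPathFrom 0 (n + n)) ↔-∘ r↔LittleSchroeder n))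
                   (cong (sCount 0) (sym (twice≡+ n)))
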